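{- Let $V$ be a finite non-empty set and $T:\mathscr{P}(V)\to\mathscr{P}(V)$ a map. Suppose $(E_1,E_2)$ is a pair of equivalence relations on $V$ with $T(X)=\mathbf{l}_{E_2}(\mathbf{u}_{E_1}(X))$ for all $X\subseteq V$. Then $(E_1,E_2)$ is the unique such pair if and only if: (i) for all $E_2$-classes $[x]_{E_2}\neq[y]_{E_2}$: $\mathbf{u}_{E_1}([x]_{E_2})\neq\mathbf{u}_{E_1}([y]_{E_2})$; and (ii) for every $E_2$-class $[x]_{E_2}$ there is an $E_1$-class $[z]_{E_1}$ with $|[x]_{E_2}\cap[z]_{E_1}|=1$.
   Context: For an equivalence relation $E$ on $V$: $\mathbf{l}_E(X)=\{x:[x]_E\subseteq X\}$, $\mathbf{u}_E(X)=\{x:[x]_E\cap X\neq\emptyset\}$. -}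

module Defs where

open import Data.Nat using (ℕ; suc)
open import Data.Bool using (Bool; true; false; _∧_; _∨_; not)
open import Data.Fin using (Fin)
open import Data.Fin.Subset using (Subset; _∩_; ∣_∣)
open import Data.Vec using (tabulate; lookup)
open import Data.List using (allFin)
open import Data.Bool.ListAction using (all; any)
open import Data.Product using (_×_; ∃)
open import Relation.Binary.PropositionalEquality using (_≡_; _≢_)

-- The finite set V is Fin n; subsets of V are Subset n (characteristic vectors).
-- A (decidable) binary relation on Fin n.
BRel : ℕ → Set
BRel n = Fin n → Fin n → Bool

record IsEqv {n : ℕ} (R : BRel n) : Set where
  field
    refl  : ∀ x → R x x ≡ true
    sym   : ∀ x y → R x y ≡ true → R y x ≡ true
    trans : ∀ x y z → R x y ≡ true → R y z ≡ true → R x z ≡ true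

cls : {n : ℕ} → BRel n → Fin n → Subset n
cls R x = tabulate (λ y → R x y)

lower : {n : ℕ} → BRel n → Subset n → Subset n
lower {n} R X = tabulate (λ x → all (λ y → not (R x y) ∨ lookup X y) (allFin n))

upper : {n : ℕ} → BRel n → Subset n → Subset n
upper {n} R X = tabulate (λ x → any (λ y → R x y ∧ lookup X y) (allFin n))

Represents : {n : ℕ} → (Subset n → Subset n) → BRel n → BRel n → Set
Represents T E₁ E₂ = ∀ X → T X ≡ lower E₂ (upper E₁ X)

UniquePair : {n : ℕ} → (Subset n → Subset n) → BRel n → BRel n → Set
UniquePair {n} T E₁ E₂ =
  ∀ (F₁ F₂ : BRel n) → IsEqv F₁ → IsEqv F₂ → Represents T F₁ F₂ →
  (∀ x y → F₁ x y ≡ E₁ x y) × (∀ x y → F₂ x y ≡ E₂ x y)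

CondI : {n : ℕ} → BRel n → BRel n → Set
CondI E₁ E₂ = ∀ x y → cls E₂ x ≢ cls E₂ y →
  upper E₁ (cls E₂ x) ≢ upper E₁ (cls E₂ y)

CondII : {n : ℕ} → BRel n → BRel n → Set
CondII E₁ E₂ = ∀ x → ∃ λ z → ∣ cls E₂ x ∩ cls E₁ z ∣ ≡ 1

-- Applying X ↦ l_{E₂}(u_{E₁}(X)) to the complement of Y tells, for every x, whether some point
-- of [x]_{E₂} has its E₁-class inside Y.  This recovers E₁ from the operator, and then the map
-- x ↦ u_{E₁}([x]_{E₂}); so any other representing pair is (E₁, F₂) with u_{E₁}[x]_{F₂} = u_{E₁}[x]_{E₂}.
-- Condition (i) forces F₂ ⊆ E₂, and the single point a of [x]_{E₂} ∩ [z]_{E₁} given by (ii) is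
-- F₂-related to every point of [x]_{E₂}, so E₂ ⊆ F₂.  Conversely, if (i) fails, merging E₂-classes
-- with equal upper images, and if (ii) fails, splitting [x]_{E₂} into the least points of the
-- E₁-classes and the rest, changes E₂ but not the operator.
module Submission where

open import Defs
open import Data.Bool using (Bool; true; false; not; _∨_)
import Data.Bool as Bool
open import Data.Bool.Properties using (T-≡; T-∧; ⇔→≡)
open import Data.Empty using (⊥-elim)
open import Data.Fin using (Fin; zero; suc; _≤_)
open import Data.Fin.Properties using (¬∀⟶∃¬; all?; any?; _≤?_; ≤-antisym) renaming (_≟_ to _≟ᶠ_)
open import Data.Fin.Subset using (Subset; _∈_; _∉_; _⊆_; _∩_; ∁; ∣_∣; ⁅_⁆; _-_; Nonempty; inside; outside)
open import Data.Fin.Subset.Properties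
  using (_∈?_; nonempty?; Empty-unique; ∣⊥∣≡0; x∈⁅x⁆; x∈⁅y⁆⇒x≡y; ∣⁅x⁆∣≡1; ⊆-refl; ⊆-antisym;
         p⊆q⇒∣p∣≤∣q∣; x∈p∧x≢y⇒x∈p-y; x∈p⇒∣p-x∣<∣p∣; x∈p∩q⁺; x∈p∩q⁻; x∉p⇒x∈∁p; x∈∁p⇒x∉p)
open import Data.List using (allFin)
open import Data.List.Membership.Propositional using (lose)
open import Data.List.Membership.Propositional.Properties using (∈-allFin)
import Data.List.Relation.Unary.All as All
open import Data.List.Relation.Unary.All.Properties using (all⁺; all⁻)
open import Data.List.Relation.Unary.Any using (satisfied)
open import Data.List.Relation.Unary.Any.Properties using (any⁺; any⁻)
open import Data.Nat using (ℕ; suc; z≤n; s≤s)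
import Data.Nat as ℕ
open import Data.Nat.Properties using (≤-<-trans; <-irrefl)
open import Data.Product using (_×_; _,_; proj₁; proj₂; ∃; ∃₂)
open import Data.Product.Properties using (×-≡,≡→≡; ×-≡,≡←≡) renaming (≡-dec to ×-≡-dec)
open import Data.Vec using (tabulate; lookup; _∷_; here; there)
open import Data.Vec.Properties using (lookup∘tabulate; []=⇒lookup; lookup⇒[]=) renaming (≡-dec to Vec-≡-dec)
open import Function using (_∘_; const; flip; case_of_)
open import Function.Bundles using (_⇔_; mk⇔; Equivalence)
open import Relation.Binary.Definitions using (DecidableEquality)
open import Relation.Binary.PropositionalEquality
  using (_≡_; _≢_; refl; sym; trans; cong; subst; module ≡-Reasoning)
open import Relation.Nullary using (¬_; Dec; yes; no; does; _×-dec_; _→-dec_; ¬?)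
open import Relation.Nullary.Decidable using (decidable-stable; dec-true; dec-false)

open Equivalence using (to; from)

private variable
  n : ℕ
  a b c x y : Fin n
  p : Subset n
  X Y : Subset n
  R S E₁ E₂ F₁ F₂ : BRel n

_≟ˢ_ : DecidableEquality (Subset n)
_≟ˢ_ = Vec-≡-dec Bool._≟_

∈⇔T-lookup : x ∈ p ⇔ Bool.T (lookup p x)
∈⇔T-lookup {x = x} {p = p} = mk⇔ (from T-≡ ∘ []=⇒lookup) (lookup⇒[]= x p ∘ to T-≡)

∈-tabulate : {f : Fin n → Bool} → x ∈ tabulate f ⇔ Bool.T (f x)
∈-tabulate {x = x} {f = f} = mk⇔
  (λ x∈ → from T-≡ (trans (sym (lookup∘tabulate f x)) ([]=⇒lookup x∈)))
  (λ fx → lookup⇒[]= x (tabulate f) (trans (lookup∘tabulate f x) (to T-≡ fx)))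

∈-cls : ∀ R → y ∈ cls R x ⇔ R x y ≡ true
∈-cls _ = mk⇔ (to T-≡ ∘ to ∈-tabulate) (from ∈-tabulate ∘ from T-≡)

cls-≡⇒≡ : cls R x ≡ cls S x → R x y ≡ S x y
cls-≡⇒≡ {R = R} {x = x} {S = S} {y = y} eq = begin
  R x y                ≡⟨ lookup∘tabulate (R x) y ⟨
  lookup (cls R x) y   ≡⟨ cong (λ v → lookup v y) eq ⟩
  lookup (cls S x) y   ≡⟨ lookup∘tabulate (S x) y ⟩
  S x y                ∎
  where open ≡-Reasoning

∈-lower : ∀ R X → x ∈ lower R X ⇔ (∀ y → R x y ≡ true → y ∈ X)
∈-lower {n} {x} R X = mk⇔
  (λ x∈ y Rxy → from ∈⇔T-lookup (implies (All.lookup (all⁺ _ (allFin n) (to ∈-tabulate x∈)) (∈-allFin y)) Rxy))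
  (λ h → from ∈-tabulate (all⁻ _ (All.universal (λ y → implied (to ∈⇔T-lookup ∘ h y)) (allFin n))))
  where
  implies : ∀ {r s} → Bool.T (not r ∨ s) → r ≡ true → Bool.T s
  implies t refl = t
  implied : ∀ {r s} → (r ≡ true → Bool.T s) → Bool.T (not r ∨ s)
  implied {false} _ = _
  implied {true}  h = h refl

∉-lower : ∀ R X → x ∉ lower R X → ∃ λ y → R x y ≡ true × y ∉ X
∉-lower {n} {x} R X x∉ =
  let (y , ¬imp) = ¬∀⟶∃¬ n _ (λ y → (R x y Bool.≟ true) →-dec (y ∈? X)) (x∉ ∘ from (∈-lower R X))
  in y , decidable-stable (R x y Bool.≟ true) (λ ¬Rxy → ¬imp (⊥-elim ∘ ¬Rxy)) , ¬imp ∘ const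

∈-upper : ∀ R X → x ∈ upper R X ⇔ ∃ λ y → R x y ≡ true × y ∈ X
∈-upper {n} {x} R X = mk⇔
  (λ x∈ → let (y , t) = satisfied (any⁻ _ (allFin n) (to ∈-tabulate x∈))
              (Rxy , y∈X) = to (T-∧ {R x y}) t
          in y , to T-≡ Rxy , from ∈⇔T-lookup y∈X)
  (λ (y , Rxy , y∈X) → from ∈-tabulate
     (any⁺ _ (lose (∈-allFin y) (from T-∧ (from T-≡ Rxy , to ∈⇔T-lookup y∈X)))))

_⊆ᵣ_ : BRel n → BRel n → Set
R ⊆ᵣ S = ∀ {x y} → R x y ≡ true → S x y ≡ true

⊆ᵣ-antisym : R ⊆ᵣ S → S ⊆ᵣ R → ∀ x y → R x y ≡ S x y
⊆ᵣ-antisym R⊆S S⊆R x y = ⇔→≡ (mk⇔ R⊆S S⊆R)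

module _ {E : BRel n} (isEqv : IsEqv E) where
  open IsEqv isEqv renaming (refl to E-refl; sym to E-sym; trans to E-trans)

  x∈cls-x : x ∈ cls E x
  x∈cls-x {x = x} = from (∈-cls E) (E-refl x)

  cls-⊆ : E x y ≡ true → cls E y ⊆ cls E x
  cls-⊆ {x = x} {y = y} Exy z∈ = from (∈-cls E) (E-trans x y _ Exy (to (∈-cls E) z∈))

  cls-≡ : E x y ≡ true → cls E x ≡ cls E y
  cls-≡ {x = x} {y = y} Exy = ⊆-antisym (cls-⊆ (E-sym x y Exy)) (cls-⊆ Exy)

  cls-≡⇒related : cls E x ≡ cls E y → E x y ≡ true
  cls-≡⇒related {y = y} eq = to (∈-cls E) (subst (y ∈_) (sym eq) x∈cls-x)

x∈p⇒⁅x⁆⊆p : x ∈ p → ⁅ x ⁆ ⊆ p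
x∈p⇒⁅x⁆⊆p {x = x} {p = p} x∈p y∈ = subst (_∈ p) (sym (x∈⁅y⁆⇒x≡y x y∈)) x∈p

x∈p⇒1≤∣p∣ : x ∈ p → 1 ℕ.≤ ∣ p ∣
x∈p⇒1≤∣p∣ {x = x} {p = p} x∈p = subst (ℕ._≤ ∣ p ∣) (∣⁅x⁆∣≡1 x) (p⊆q⇒∣p∣≤∣q∣ (x∈p⇒⁅x⁆⊆p x∈p))

∣p∣≡1⇒Nonempty : ∣ p ∣ ≡ 1 → Nonempty p
∣p∣≡1⇒Nonempty {n} {p} ∣p∣≡1 = decidable-stable (nonempty? p) λ empty →
  case trans (sym (∣⊥∣≡0 n)) (trans (cong ∣_∣ (sym (Empty-unique empty))) ∣p∣≡1) of λ ()

∣p∣≡1⇒unique : ∣ p ∣ ≡ 1 → x ∈ p → y ∈ p → y ≡ x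
∣p∣≡1⇒unique {p = p} {x = x} {y = y} ∣p∣≡1 x∈p y∈p = decidable-stable (y ≟ᶠ x) λ y≢x →
  <-irrefl refl (≤-<-trans (x∈p⇒1≤∣p∣ (x∈p∧x≢y⇒x∈p-y y∈p y≢x))
                           (subst (∣ p - x ∣ ℕ.<_) ∣p∣≡1 (x∈p⇒∣p-x∣<∣p∣ x∈p)))

∣p∣≢1⇒∃≢ : ∣ p ∣ ≢ 1 → x ∈ p → ∃ λ y → y ∈ p × y ≢ x
∣p∣≢1⇒∃≢ {p = p} {x = x} ∣p∣≢1 x∈p =
  decidable-stable (any? λ y → y ∈? p ×-dec ¬? (y ≟ᶠ x)) λ ¬other →
    ∣p∣≢1 (trans (cong ∣_∣ (⊆-antisym (p⊆⁅x⁆ ¬other) (x∈p⇒⁅x⁆⊆p x∈p))) (∣⁅x⁆∣≡1 x))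
  where
  p⊆⁅x⁆ : ¬ (∃ λ y → y ∈ p × y ≢ x) → p ⊆ ⁅ x ⁆
  p⊆⁅x⁆ ¬other {y} y∈p =
    subst (_∈ ⁅ x ⁆) (decidable-stable (x ≟ᶠ y) λ x≢y → ¬other (y , y∈p , x≢y ∘ sym)) (x∈⁅x⁆ x)

∃-least : x ∈ p → ∃ λ m → m ∈ p × (∀ {y} → y ∈ p → m ≤ y)
∃-least {p = inside ∷ p} _ = zero , here , λ _ → z≤n
∃-least {x = suc x} {p = outside ∷ p} (there x∈p) =
  let (m , m∈p , m≤) = ∃-least x∈p
  in suc m , there m∈p , λ { (there y∈p) → s≤s (m≤ y∈p) }

module LeastInClasses {E : BRel n} (isEqv : IsEqv E) (C : Subset n) where
  open IsEqv isEqv renaming (sym to E-sym; trans to E-trans)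

  IsLeast : Fin n → Set
  IsLeast c = c ∈ C × (∀ d → d ∈ C ∩ cls E c → c ≤ d)

  isLeast? : ∀ c → Dec (IsLeast c)
  isLeast? c = c ∈? C ×-dec all? (λ d → d ∈? C ∩ cls E c →-dec c ≤? d)

  least : Fin n → Bool
  least c = does (isLeast? c)

  least-∉ : c ∉ C → least c ≡ false
  least-∉ {c} c∉C = dec-false (isLeast? c) (c∉C ∘ proj₁)

  least-unique : IsLeast a → IsLeast b → E a b ≡ true → a ≡ b
  least-unique {a} {b} (a∈C , a≤) (b∈C , b≤) Eab =
    ≤-antisym (a≤ b (x∈p∩q⁺ (b∈C , from (∈-cls E) Eab)))
              (b≤ a (x∈p∩q⁺ (a∈C , from (∈-cls E) (E-sym a b Eab))))

  least-exists : b ∈ C → ∃ λ m → m ∈ C ∩ cls E b × IsLeast m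
  least-exists b∈C with ∃-least (x∈p∩q⁺ (b∈C , x∈cls-x isEqv))
  ... | m , m∈ , m≤ = m , m∈ , m∈C , λ d d∈ →
    let (d∈C , d∈cls-m) = x∈p∩q⁻ C _ d∈
    in m≤ (x∈p∩q⁺ (d∈C , cls-⊆ isEqv (to (∈-cls E) (proj₂ (x∈p∩q⁻ C _ m∈))) d∈cls-m))
    where m∈C = proj₁ (x∈p∩q⁻ C _ m∈)

  least-splits : (∀ z → ∣ C ∩ cls E z ∣ ≢ 1) → b ∈ C →
                 ∀ s → ∃ λ c → c ∈ C ∩ cls E b × least c ≡ s
  least-splits {b = b} no-singleton b∈C s with least-exists b∈C
  least-splits {b = b} no-singleton b∈C true  | m , m∈ , m-least = m , m∈ , dec-true (isLeast? m) m-least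
  least-splits {b = b} no-singleton b∈C false | m , m∈ , m-least
    with ∣p∣≢1⇒∃≢ (no-singleton b) m∈
  ... | d , d∈ , d≢m = d , d∈ , dec-false (isLeast? d) λ d-least →
    d≢m (least-unique d-least m-least (E-trans d b m (E-sym b d (class d∈)) (class m∈)))
    where
    class : a ∈ C ∩ cls E b → E b a ≡ true
    class a∈ = to (∈-cls E) (proj₂ (x∈p∩q⁻ C _ a∈))

lowerUpper : BRel n → BRel n → Subset n → Subset n
lowerUpper E₁ E₂ X = lower E₂ (upper E₁ X)

Represents-sym : Represents (lowerUpper E₁ E₂) F₁ F₂ → Represents (lowerUpper F₁ F₂) E₁ E₂
Represents-sym same X = sym (same X)

upper-mono : R ⊆ᵣ S → upper R X ⊆ upper S X
upper-mono {R = R} {S = S} {X = X} R⊆S x∈ =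
  let (y , Rxy , y∈X) = to (∈-upper R X) x∈ in from (∈-upper S X) (y , R⊆S Rxy , y∈X)

∉-lowerUpper-∁ : x ∉ lowerUpper R S (∁ Y) ⇔ ∃ λ y → S x y ≡ true × cls R y ⊆ Y
∉-lowerUpper-∁ {R = R} {S = S} {Y = Y} = mk⇔
  (λ x∉ → let (y , Sxy , y∉) = ∉-lower S (upper R (∁ Y)) x∉
          in y , Sxy , λ {w} w∈ → decidable-stable (w ∈? Y) λ w∉Y →
               y∉ (from (∈-upper R (∁ Y)) (w , to (∈-cls R) w∈ , x∉p⇒x∈∁p w∉Y)))
  (λ (y , Sxy , y⊆Y) x∈ →
     let (w , Ryw , w∈∁Y) = to (∈-upper R (∁ Y)) (to (∈-lower S (upper R (∁ Y))) x∈ y Sxy)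
     in x∈∁p⇒x∉p w∈∁Y (y⊆Y (from (∈-cls R) Ryw)))

lowerUpper-transfer : Represents (lowerUpper E₁ E₂) F₁ F₂ → E₂ x y ≡ true → cls E₁ y ⊆ Y →
                      ∃ λ y′ → F₂ x y′ ≡ true × cls F₁ y′ ⊆ Y
lowerUpper-transfer {E₁ = E₁} {E₂ = E₂} {F₁ = F₁} {F₂ = F₂} {x = x} {Y = Y} same E₂xy y⊆Y =
  to (∉-lowerUpper-∁ {R = F₁} {S = F₂})
     (from (∉-lowerUpper-∁ {R = E₁} {S = E₂}) (_ , E₂xy , y⊆Y) ∘ subst (x ∈_) (sym (same (∁ Y))))

lowerUpper-determines-cls₁ : IsEqv E₁ → IsEqv F₁ → (∀ x → E₂ x x ≡ true) →
                             Represents (lowerUpper E₁ E₂) F₁ F₂ → ∀ x → cls F₁ x ≡ cls E₁ x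
lowerUpper-determines-cls₁ {E₁ = E₁} {F₁ = F₁} isE₁ isF₁ E₂-refl same x =
  let (y , F₂xy , y⊆x) = lowerUpper-transfer same (E₂-refl x) ⊆-refl
      (w , _ , w⊆y) = lowerUpper-transfer (Represents-sym same) F₂xy ⊆-refl
      x⊆y : cls E₁ x ⊆ cls F₁ y
      x⊆y = subst (_⊆ cls F₁ y) (sym (cls-≡ isE₁ (to (∈-cls E₁) (y⊆x (w⊆y (x∈cls-x isE₁)))))) w⊆y
  in begin
    cls F₁ x  ≡⟨ cls-≡ isF₁ (to (∈-cls F₁) (x⊆y (x∈cls-x isE₁))) ⟨
    cls F₁ y  ≡⟨ ⊆-antisym y⊆x x⊆y ⟩
    cls E₁ x  ∎
  where open ≡-Reasoning

Represents-cong₁ : (∀ x y → F₁ x y ≡ E₁ x y) →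
                   Represents (lowerUpper E₁ E₂) F₁ F₂ → Represents (lowerUpper E₁ E₂) E₁ F₂
Represents-cong₁ {F₁ = F₁} {E₁ = E₁} {F₂ = F₂} F₁≡E₁ same X =
  trans (same X) (cong (lower F₂) (⊆-antisym (upper-mono {X = X} F₁⊆E₁) (upper-mono {X = X} E₁⊆F₁)))
  where
  F₁⊆E₁ : F₁ ⊆ᵣ E₁
  F₁⊆E₁ {x} {y} = subst (_≡ true) (F₁≡E₁ x y)
  E₁⊆F₁ : E₁ ⊆ᵣ F₁
  E₁⊆F₁ {x} {y} = subst (_≡ true) (sym (F₁≡E₁ x y))

upper-cls-⊆ : IsEqv E₁ → Represents (lowerUpper E₁ E₂) E₁ F₂ →
              upper E₁ (cls E₂ x) ⊆ upper E₁ (cls F₂ x)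
upper-cls-⊆ {E₁ = E₁} {E₂ = E₂} {F₂ = F₂} {x = x} isE₁ same z∈ =
  let (y , E₁zy , y∈) = to (∈-upper E₁ (cls E₂ x)) z∈
      (y′ , F₂xy′ , y′⊆z) = lowerUpper-transfer same (to (∈-cls E₂) y∈) (cls-⊆ isE₁ E₁zy)
  in from (∈-upper E₁ (cls F₂ x)) (y′ , to (∈-cls E₁) (y′⊆z (x∈cls-x isE₁)) , from (∈-cls F₂) F₂xy′)

condI⇒related : IsEqv E₂ → CondI E₁ E₂ → upper E₁ (cls E₂ x) ≡ upper E₁ (cls E₂ y) → E₂ x y ≡ true
condI⇒related {E₂ = E₂} {x = x} {y = y} isE₂ condI same-image =
  cls-≡⇒related isE₂ (decidable-stable (cls E₂ x ≟ˢ cls E₂ y) λ cls≢ →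
    condI x y cls≢ same-image)

condI⇒⊆ : IsEqv E₂ → IsEqv F₂ → CondI E₁ E₂ →
          (∀ x → upper E₁ (cls E₂ x) ≡ upper E₁ (cls F₂ x)) → F₂ ⊆ᵣ E₂
condI⇒⊆ {E₂ = E₂} {F₂ = F₂} {E₁ = E₁} isE₂ isF₂ condI same-image {x} {y} F₂xy =
  condI⇒related isE₂ condI (begin
    upper E₁ (cls E₂ x)  ≡⟨ same-image x ⟩
    upper E₁ (cls F₂ x)  ≡⟨ cong (upper E₁) (cls-≡ isF₂ F₂xy) ⟩
    upper E₁ (cls F₂ y)  ≡⟨ same-image y ⟨
    upper E₁ (cls E₂ y)  ∎)
  where open ≡-Reasoning

condII⇒⊇ : IsEqv E₂ → IsEqv F₂ → CondII E₁ E₂ →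
           (∀ x → upper E₁ (cls E₂ x) ⊆ upper E₁ (cls F₂ x)) → F₂ ⊆ᵣ E₂ → E₂ ⊆ᵣ F₂
condII⇒⊇ {E₂ = E₂} {F₂ = F₂} {E₁ = E₁} isE₂ isF₂ condII image-⊆ F₂⊆E₂ {x} {x′} E₂xx′
  with condII x
... | z , singleton with ∣p∣≡1⇒Nonempty singleton
... | a , a∈ = F₂-trans x a x′ (F₂-to-a x (E₂-refl x)) (F₂-sym x′ a (F₂-to-a x′ E₂xx′))
  where
  open IsEqv isE₂ renaming (refl to E₂-refl; sym to E₂-sym; trans to E₂-trans)
  open IsEqv isF₂ renaming (sym to F₂-sym; trans to F₂-trans)
  E₂xa = to (∈-cls E₂) (proj₁ (x∈p∩q⁻ (cls E₂ x) _ a∈))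
  E₁za = to (∈-cls E₁) (proj₂ (x∈p∩q⁻ (cls E₂ x) _ a∈))
  F₂-to-a : ∀ v → E₂ x v ≡ true → F₂ v a ≡ true
  F₂-to-a v E₂xv
    with to (∈-upper E₁ (cls F₂ v)) (image-⊆ v (from (∈-upper E₁ (cls E₂ v))
           (a , E₁za , from (∈-cls E₂) (E₂-trans v x a (E₂-sym x v E₂xv) E₂xa))))
  ... | y , E₁zy , y∈ = subst (λ t → F₂ v t ≡ true) (∣p∣≡1⇒unique singleton a∈ y∈meet) F₂vy
    where
    F₂vy = to (∈-cls F₂) y∈
    y∈meet = x∈p∩q⁺ (from (∈-cls E₂) (E₂-trans x v y E₂xv (F₂⊆E₂ F₂vy)) , from (∈-cls E₁) E₁zy)

conditions⇒uniquePair : {T : Subset n → Subset n} → IsEqv E₁ → IsEqv E₂ → Represents T E₁ E₂ →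
                        CondI E₁ E₂ → CondII E₁ E₂ → UniquePair T E₁ E₂
conditions⇒uniquePair {E₁ = E₁} {E₂ = E₂} isE₁ isE₂ rep condI condII F₁ F₂ isF₁ isF₂ repF =
  F₁≡E₁ , ⊆ᵣ-antisym F₂⊆E₂ (condII⇒⊇ isE₂ isF₂ condII (λ x → subst (_ ⊆_) (same-image x) ⊆-refl) F₂⊆E₂)
  where
  same : Represents (lowerUpper E₁ E₂) F₁ F₂
  same X = trans (sym (rep X)) (repF X)
  F₁≡E₁ : ∀ x y → F₁ x y ≡ E₁ x y
  F₁≡E₁ x _ = cls-≡⇒≡ {R = F₁} {S = E₁} (lowerUpper-determines-cls₁ isE₁ isF₁ (IsEqv.refl isE₂) same x)
  same-image : ∀ x → upper E₁ (cls E₂ x) ≡ upper E₁ (cls F₂ x)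
  same-image x = ⊆-antisym (upper-cls-⊆ isE₁ (Represents-cong₁ F₁≡E₁ same))
                           (upper-cls-⊆ isE₁ (Represents-sym (Represents-cong₁ F₁≡E₁ same)))
  F₂⊆E₂ : F₂ ⊆ᵣ E₂
  F₂⊆E₂ = condI⇒⊆ isE₂ isF₂ condI same-image

lowerUpper-coarsening : IsEqv E₁ → R ⊆ᵣ S → (∀ {a b} → S a b ≡ true → ∃ λ c → R a c ≡ true × E₁ b c ≡ true) →
                        ∀ X → lowerUpper E₁ R X ≡ lowerUpper E₁ S X
lowerUpper-coarsening {E₁ = E₁} {R = R} {S = S} isE₁ R⊆S S-covered X = ⊆-antisym lowerR⊆lowerS lowerS⊆lowerR
  where
  lowerR⊆lowerS : lower R (upper E₁ X) ⊆ lower S (upper E₁ X)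
  lowerR⊆lowerS x∈ = from (∈-lower S (upper E₁ X)) λ b Sxb →
    let (c , Rxc , E₁bc) = S-covered Sxb
        (w , E₁cw , w∈X) = to (∈-upper E₁ X) (to (∈-lower R (upper E₁ X)) x∈ c Rxc)
    in from (∈-upper E₁ X) (w , IsEqv.trans isE₁ b c w E₁bc E₁cw , w∈X)
  lowerS⊆lowerR : lower S (upper E₁ X) ⊆ lower R (upper E₁ X)
  lowerS⊆lowerR x∈ = from (∈-lower R (upper E₁ X)) λ b Rxb → to (∈-lower S (upper E₁ X)) x∈ b (R⊆S Rxb)

kernel : {A : Set} → DecidableEquality A → (Fin n → A) → BRel n
kernel _≟_ f a b = does (f a ≟ f b)

module _ {A : Set} (_≟_ : DecidableEquality A) (f : Fin n → A) where

  kernel⁺ : f a ≡ f b → kernel _≟_ f a b ≡ true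
  kernel⁺ {a} {b} = dec-true (f a ≟ f b)

  kernel⁻ : kernel _≟_ f a b ≡ true → f a ≡ f b
  kernel⁻ {a} {b} with f a ≟ f b
  ... | yes fa≡fb = λ _ → fa≡fb
  ... | no  _     = λ ()

  kernel-isEqv : IsEqv (kernel _≟_ f)
  kernel-isEqv = record
    { refl  = λ _ → kernel⁺ refl
    ; sym   = λ a b → kernel⁺ ∘ sym ∘ kernel⁻ {a} {b}
    ; trans = λ a b c ab bc → kernel⁺ (trans (kernel⁻ {a} {b} ab) (kernel⁻ {b} {c} bc))
    }

uniquePair⇒condI : {T : Subset n → Subset n} → IsEqv E₁ → IsEqv E₂ → Represents T E₁ E₂ →
                   UniquePair T E₁ E₂ → CondI E₁ E₂
uniquePair⇒condI {n} {E₁ = E₁} {E₂ = E₂} isE₁ isE₂ rep unique x y cls≢ same-image =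
  cls≢ (cls-≡ isE₂ (subst (_≡ true) (proj₂ (unique E₁ K isE₁ (kernel-isEqv _≟ˢ_ image) repK) x y)
                                    (kernel⁺ _≟ˢ_ image same-image)))
  where
  image : Fin n → Subset n
  image a = upper E₁ (cls E₂ a)
  K : BRel n
  K = kernel _≟ˢ_ image
  E₂⊆K : E₂ ⊆ᵣ K
  E₂⊆K = kernel⁺ _≟ˢ_ image ∘ cong (upper E₁) ∘ cls-≡ isE₂
  K-covered : K a b ≡ true → ∃ λ c → E₂ a c ≡ true × E₁ b c ≡ true
  K-covered {a} {b} Kab
    with to (∈-upper E₁ (cls E₂ a))
            (subst (b ∈_) (sym (kernel⁻ _≟ˢ_ image Kab))
                   (from (∈-upper E₁ (cls E₂ b)) (b , IsEqv.refl isE₁ b , x∈cls-x isE₂)))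
  ... | c , E₁bc , c∈ = c , to (∈-cls E₂) c∈ , E₁bc
  repK : Represents _ E₁ K
  repK X = trans (rep X) (lowerUpper-coarsening isE₁ E₂⊆K K-covered X)

-- refined cuts the E₂-class of x into the least points of its E₁-classes and the rest; as no
-- E₁-class meets it in a single point, each one that meets it meets both parts.
module Refinement {E₁ E₂ : BRel n} (isE₁ : IsEqv E₁) (isE₂ : IsEqv E₂) (x : Fin n)
                  (no-singleton : ∀ z → ∣ cls E₂ x ∩ cls E₁ z ∣ ≢ 1) where
  open IsEqv isE₂ renaming (sym to E₂-sym; trans to E₂-trans)
  open LeastInClasses isE₁ (cls E₂ x)

  _≟ᵖ_ : DecidableEquality (Subset n × Bool)
  _≟ᵖ_ = ×-≡-dec _≟ˢ_ Bool._≟_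

  split : Fin n → Subset n × Bool
  split a = cls E₂ a , least a

  refined : BRel n
  refined = kernel _≟ᵖ_ split

  refined-isEqv : IsEqv refined
  refined-isEqv = kernel-isEqv _≟ᵖ_ split

  refined⊆E₂ : refined ⊆ᵣ E₂
  refined⊆E₂ {a} {b} = cls-≡⇒related isE₂ ∘ proj₁ ∘ ×-≡,≡←≡ ∘ kernel⁻ _≟ᵖ_ split {a} {b}

  ∈-class : a ∈ cls E₂ x → E₂ a b ≡ true → b ∈ cls E₂ x
  ∈-class a∈ E₂ab = cls-⊆ isE₂ (to (∈-cls E₂) a∈) (from (∈-cls E₂) E₂ab)

  related-in-class : a ∈ cls E₂ x → b ∈ cls E₂ x → E₂ a b ≡ true
  related-in-class {a} {b} a∈ b∈ = E₂-trans a x b (E₂-sym x a (to (∈-cls E₂) a∈)) (to (∈-cls E₂) b∈)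

  covered-outside : a ∉ cls E₂ x → E₂ a b ≡ true → refined a b ≡ true
  covered-outside {a} {b} a∉ E₂ab =
    kernel⁺ _≟ᵖ_ split (×-≡,≡→≡ (cls-≡ isE₂ E₂ab , trans (least-∉ a∉) (sym (least-∉ b∉))))
    where b∉ = a∉ ∘ flip ∈-class (E₂-sym a b E₂ab)

  covered-inside : a ∈ cls E₂ x → E₂ a b ≡ true → ∃ λ c → refined a c ≡ true × E₁ b c ≡ true
  covered-inside {a} a∈ E₂ab with least-splits no-singleton (∈-class a∈ E₂ab) (least a)
  ... | c , c∈ , same-least =
    let (c∈C , c∈cls-b) = x∈p∩q⁻ (cls E₂ x) _ c∈
    in c , kernel⁺ _≟ᵖ_ split (×-≡,≡→≡ (cls-≡ isE₂ (related-in-class a∈ c∈C) , sym same-least))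
         , to (∈-cls E₁) c∈cls-b

  refined-covered : E₂ a b ≡ true → ∃ λ c → refined a c ≡ true × E₁ b c ≡ true
  refined-covered {a} {b} E₂ab = case a ∈? cls E₂ x of λ
    { (yes a∈) → covered-inside a∈ E₂ab
    ; (no a∉)  → b , covered-outside a∉ E₂ab , IsEqv.refl isE₁ b
    }

  refined-proper : ∃₂ λ c d → E₂ c d ≡ true × refined c d ≢ true
  refined-proper =
    let (c , c∈ , least-c) = least-splits no-singleton (x∈cls-x isE₂) true
        (d , d∈ , least-d) = least-splits no-singleton (x∈cls-x isE₂) false
    in c , d , related-in-class (proj₁ (x∈p∩q⁻ _ _ c∈)) (proj₁ (x∈p∩q⁻ _ _ d∈)) , λ refined-cd →
         case trans (sym least-c) (trans (proj₂ (×-≡,≡←≡ (kernel⁻ _≟ᵖ_ split refined-cd))) least-d) of λ ()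

uniquePair⇒condII : {T : Subset n → Subset n} → IsEqv E₁ → IsEqv E₂ → Represents T E₁ E₂ →
                    UniquePair T E₁ E₂ → CondII E₁ E₂
uniquePair⇒condII {E₁ = E₁} {E₂ = E₂} isE₁ isE₂ rep unique x =
  decidable-stable (any? λ z → ∣ cls E₂ x ∩ cls E₁ z ∣ ℕ.≟ 1) λ ¬condII →
    let open Refinement isE₁ isE₂ x (λ z single → ¬condII (z , single))
        repF = λ X → trans (rep X) (sym (lowerUpper-coarsening isE₁ refined⊆E₂ refined-covered X))
        (c , d , E₂cd , ¬refined-cd) = refined-proper
    in ¬refined-cd (trans (proj₂ (unique E₁ refined isE₁ refined-isEqv repF) c d) E₂cd)

mainTheorem20 : ∀ (m : ℕ) (T : Subset (suc m) → Subset (suc m)) (E₁ E₂ : BRel (suc m)) →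
                  IsEqv E₁ → IsEqv E₂ → Represents T E₁ E₂ →
                  UniquePair T E₁ E₂ ⇔ (CondI E₁ E₂ × CondII E₁ E₂)
mainTheorem20 m T E₁ E₂ isE₁ isE₂ rep = mk⇔
  (λ unique → uniquePair⇒condI isE₁ isE₂ rep unique , uniquePair⇒condII isE₁ isE₂ rep unique)
  (λ (condI , condII) → conditions⇒uniquePair isE₁ isE₂ rep condI condII)
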